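{- For all positive integers $s,t$, $$\sum_{n=0}^{\infty}\frac{t\,\{n\}_{s,t}}{(s+t)^{n+1}}=\frac{1}{s+t-1}.$$
   Context: For integers (or indeterminates) $s,t$, the generalized Fibonacci numbers $\{n\}_{s,t}$ are defined by $\{0\}_{s,t}=0$, $\{1\}_{s,t}=1$ and $\{n\}_{s,t}=s\{n-1\}_{s,t}+t\{n-2\}_{s,t}$ for $n\ge2$. -}

module Defs where

open import Data.Nat using (ℕ; zero; suc; _+_; _*_; _∸_; _^_; _≥_; NonZero)
open import Data.Nat.Properties using (m^n≢0)
open import Data.Integer using (+_)
open import Data.Product using (Σ)
open import Data.Rational using (ℚ; 0ℚ; _/_; _<_; _-_; ∣_∣) renaming (_+_ to _+ℚ_)

-- Generalized Fibonacci numbers {n}_{s,t} (here with natural-number parameters,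
-- which suffices since s,t are positive integers in the statement).
fib : ℕ → ℕ → ℕ → ℕ
fib s t zero = 0
fib s t (suc zero) = 1
fib s t (suc (suc n)) = s * fib s t (suc n) + t * fib s t n

nz-s+t : ∀ s t .{{_ : NonZero s}} → NonZero (s + t)
nz-s+t (suc s) t = _

nz-s+t∸1 : ∀ s t .{{_ : NonZero s}} .{{_ : NonZero t}} → NonZero (s + t ∸ 1)
nz-s+t∸1 (suc zero) (suc t) = _
nz-s+t∸1 (suc (suc s)) t = _

term : (s t : ℕ) .{{_ : NonZero s}} → ℕ → ℚ
term s t n = (+ (t * fib s t n)) / ((s + t) ^ suc n)
  where instance
    _ : NonZero ((s + t) ^ suc n)
    _ = m^n≢0 (s + t) (suc n) {{nz-s+t s t}}

partialSum : (s t : ℕ) .{{_ : NonZero s}} → ℕ → ℚ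
partialSum s t zero = 0ℚ
partialSum s t (suc N) = partialSum s t N +ℚ term s t N

ConvergesTo : (ℕ → ℚ) → ℚ → Set
ConvergesTo a L = ∀ (ε : ℚ) → 0ℚ < ε → Σ ℕ λ N → ∀ n → n ≥ N → ∣ a n - L ∣ < ε

module Submission where

-- Put q = s + t and r = q - 1.  The tail of the series is known exactly: with
-- G n = {n+1} + t{n} and E n = G n / (r qⁿ), the Fibonacci recurrence gives
-- t{n}·r + G (n+1) = q · G n, i.e. E n drops by exactly the n-th term t{n}/q^(n+1).
-- As E 0 = 1/r, telescoping yields  S N + E N = 1/r  for every partial sum S N, so
-- it remains to show E n → 0.  The ratio a/3 with a = 3q - 1 dominates the growth
-- of {n} (3ⁿ{n} ≤ aⁿ), so E n is a constant times at most (a/(a+1))ⁿ, which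
-- Bernoulli's inequality makes explicitly small.

open import Defs
open import Data.Nat using (ℕ; zero; suc; _+_; _*_; _∸_; _^_; _≤_; _<_; _≥_; z≤n; s≤s; NonZero; >-nonZero; >-nonZero⁻¹)
open import Data.Nat.Properties
open import Data.Nat.Coprimality using (Coprime)
open import Data.Nat.Tactic.RingSolver using (solve-∀)
open import Data.Integer using (+_; -[1+_])
import Data.Integer as ℤ
import Data.Integer.Properties as ℤ
open import Data.Rational using (ℚ; mkℚ; 0ℚ; _/_; ∣_∣; -_; toℚᵘ)
  renaming (_+_ to _+ℚ_; _-_ to _-ℚ_; _≤_ to _≤ℚ_; _<_ to _<ℚ_)
import Data.Rational as ℚ
import Data.Rational.Properties as ℚ
import Data.Rational.Unnormalised as ℚᵘ
import Data.Rational.Unnormalised.Properties as ℚᵘ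
open import Data.Product using (Σ; _×_; _,_; proj₁; proj₂; map₂)
open import Relation.Binary.PropositionalEquality

toℚᵘ-/ : ∀ a b .{{_ : NonZero b}} → toℚᵘ ((+ a) / b) ℚᵘ.≃ ((+ a) ℚᵘ./ b)
toℚᵘ-/ a (suc b) = ℚ.toℚᵘ-fromℚᵘ (ℚᵘ.mkℚᵘ (+ a) b)

cross-ℤ : ∀ a b c d e f → (a * d + c * b) * f ≡ e * (b * d) →
          (+ a ℤ.* + d ℤ.+ + c ℤ.* + b) ℤ.* + f ≡ + e ℤ.* + (b * d)
cross-ℤ a b c d e f cross = begin
  (+ a ℤ.* + d ℤ.+ + c ℤ.* + b) ℤ.* + f  ≡⟨ cong (ℤ._* + f) (cong₂ ℤ._+_ (ℤ.pos-* a d) (ℤ.pos-* c b)) ⟨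
  (+ (a * d) ℤ.+ + (c * b)) ℤ.* + f      ≡⟨ cong (ℤ._* + f) (ℤ.pos-+ (a * d) (c * b)) ⟨
  + (a * d + c * b) ℤ.* + f              ≡⟨ ℤ.pos-* (a * d + c * b) f ⟨
  + ((a * d + c * b) * f)                ≡⟨ cong +_ cross ⟩
  + (e * (b * d))                        ≡⟨ ℤ.pos-* e (b * d) ⟩
  + e ℤ.* + (b * d)                      ∎
  where open ≡-Reasoning

/-+-cross : ∀ a b c d e f .{{_ : NonZero b}} .{{_ : NonZero d}} .{{_ : NonZero f}} →
            (a * d + c * b) * f ≡ e * (b * d) → (+ a) / b +ℚ (+ c) / d ≡ (+ e) / f
/-+-cross a b@(suc _) c d@(suc _) e f@(suc _) cross = ℚ.toℚᵘ-injective (begin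
    toℚᵘ ((+ a) / b +ℚ (+ c) / d)             ≈⟨ ℚ.toℚᵘ-homo-+ ((+ a) / b) ((+ c) / d) ⟩
    toℚᵘ ((+ a) / b) ℚᵘ.+ toℚᵘ ((+ c) / d)    ≈⟨ ℚᵘ.+-cong (toℚᵘ-/ a b) (toℚᵘ-/ c d) ⟩
    (+ a) ℚᵘ./ b ℚᵘ.+ (+ c) ℚᵘ./ d            ≈⟨ ℚᵘ.*≡* (cross-ℤ a b c d e f cross) ⟩
    (+ e) ℚᵘ./ f                              ≈⟨ toℚᵘ-/ e f ⟨
    toℚᵘ ((+ e) / f)                          ∎)
  where open ℚᵘ.≃-Reasoning

/-nonNeg : ∀ a b .{{_ : NonZero b}} → 0ℚ ≤ℚ (+ a) / b
/-nonNeg a b = ℚ.nonNegative⁻¹ ((+ a) / b) {{ℚ.normalize-nonNeg a b}}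

/-< : ∀ a b c e .{{_ : NonZero b}} .{cop : Coprime c (suc e)} →
      a * suc e < c * b → (+ a) / b <ℚ mkℚ (+ c) e cop
/-< a b@(suc _) c e ae<cb = ℚ.toℚᵘ-cancel-< (ℚᵘ.<-respˡ-≃ (ℚᵘ.≃-sym (toℚᵘ-/ a b))
  (ℚᵘ.*<* (subst₂ ℤ._<_ (ℤ.pos-* a (suc e)) (ℤ.pos-* c b) (ℤ.+<+ ae<cb))))

telescope : (a E S : ℕ → ℚ) → S 0 ≡ 0ℚ → (∀ N → S (suc N) ≡ S N +ℚ a N) →
            (∀ N → a N +ℚ E (suc N) ≡ E N) → ∀ N → S N +ℚ E N ≡ E 0
telescope a E S S0 S-suc drop zero = trans (cong (_+ℚ E 0) S0) (ℚ.+-identityˡ (E 0))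
telescope a E S S0 S-suc drop (suc N) = begin
  S (suc N) +ℚ E (suc N)       ≡⟨ cong (_+ℚ E (suc N)) (S-suc N) ⟩
  (S N +ℚ a N) +ℚ E (suc N)    ≡⟨ ℚ.+-assoc (S N) (a N) (E (suc N)) ⟩
  S N +ℚ (a N +ℚ E (suc N))    ≡⟨ cong (S N +ℚ_) (drop N) ⟩
  S N +ℚ E N                   ≡⟨ telescope a E S S0 S-suc drop N ⟩
  E 0                          ∎
  where open ≡-Reasoning

∣p-[p+e]∣≡e : ∀ p e → 0ℚ ≤ℚ e → ∣ p -ℚ (p +ℚ e) ∣ ≡ e
∣p-[p+e]∣≡e p e 0≤e = begin
  ∣ p +ℚ - (p +ℚ e) ∣     ≡⟨ cong (λ x → ∣ p +ℚ x ∣) (ℚ.neg-distrib-+ p e) ⟩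
  ∣ p +ℚ (- p +ℚ - e) ∣   ≡⟨ cong ∣_∣ (ℚ.+-assoc p (- p) (- e)) ⟨
  ∣ (p +ℚ - p) +ℚ - e ∣   ≡⟨ cong (λ x → ∣ x +ℚ - e ∣) (ℚ.+-inverseʳ p) ⟩
  ∣ 0ℚ +ℚ - e ∣           ≡⟨ cong ∣_∣ (ℚ.+-identityˡ (- e)) ⟩
  ∣ - e ∣                 ≡⟨ ℚ.∣-p∣≡∣p∣ e ⟩
  ∣ e ∣                   ≡⟨ ℚ.0≤p⇒∣p∣≡p 0≤e ⟩
  e                       ∎
  where open ≡-Reasoning

converges-by-tail : (S E : ℕ → ℚ) (L : ℚ) → (∀ n → S n +ℚ E n ≡ L) → (∀ n → 0ℚ ≤ℚ E n) →
                    (∀ ε → 0ℚ <ℚ ε → Σ ℕ λ N → ∀ n → n ≥ N → E n <ℚ ε) → ConvergesTo S L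
converges-by-tail S E L sum-to-L E≥0 E-small ε ε>0 =
  map₂ (λ E<ε n n≥N → subst (_<ℚ ε) (sym (distance n)) (E<ε n n≥N)) (E-small ε ε>0)
  where
  distance : ∀ n → ∣ S n -ℚ L ∣ ≡ E n
  distance n = trans (cong (λ x → ∣ S n -ℚ x ∣) (sym (sum-to-L n))) (∣p-[p+e]∣≡e (S n) (E n) (E≥0 n))

^-distribʳ-* : ∀ m n k → (m * n) ^ k ≡ m ^ k * n ^ k
^-distribʳ-* m n zero = refl
^-distribʳ-* m n (suc k) = begin
  m * n * (m * n) ^ k         ≡⟨ cong (m * n *_) (^-distribʳ-* m n k) ⟩
  m * n * (m ^ k * n ^ k)     ≡⟨ interchange m n (m ^ k) (n ^ k) ⟩
  m * m ^ k * (n * n ^ k)     ∎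
  where
  open ≡-Reasoning
  interchange : ∀ m n x y → m * n * (x * y) ≡ m * x * (n * y)
  interchange = solve-∀

-- Generalized Fibonacci numbers are dominated by powers of any ratio μ = a / b
-- with μ ≥ 1 and μ² ≥ sμ + t:  bⁿ {n}_{s,t} ≤ aⁿ.
fib-growth : ∀ s t a b → b ≤ a → b * s * a + b * b * t ≤ a * a →
             ∀ n → b ^ n * fib s t n ≤ a ^ n
fib-growth s t a b b≤a μ²≥sμ+t n = proj₁ (consecutive n)
  where
  open ≤-Reasoning
  -- the bound for n and n + 1 simultaneously, as the recurrence needs both
  consecutive : ∀ n → b ^ n * fib s t n ≤ a ^ n × b ^ suc n * fib s t (suc n) ≤ a ^ suc n
  consecutive zero = z≤n , (begin
    b * 1 * 1   ≡⟨ *-identityʳ (b * 1) ⟩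
    b * 1       ≡⟨ *-identityʳ b ⟩
    b           ≤⟨ b≤a ⟩
    a           ≡⟨ *-identityʳ a ⟨
    a * 1       ∎)
  consecutive (suc n) = bound₁ , (begin
    b * (b * B) * (s * F₁ + t * F₀)                     ≡⟨ regroup b B s t F₁ F₀ ⟩
    b * s * (b * B * F₁) + b * b * t * (B * F₀)         ≤⟨ +-mono-≤ (*-monoʳ-≤ (b * s) bound₁) (*-monoʳ-≤ (b * b * t) bound₀) ⟩
    b * s * (a * A) + b * b * t * A                     ≡⟨ factor b s t a A ⟩
    (b * s * a + b * b * t) * A                         ≤⟨ *-monoˡ-≤ A μ²≥sμ+t ⟩
    a * a * A                                           ≡⟨ *-assoc a a A ⟩
    a * (a * A)                                         ∎)
    where
    B = b ^ n
    A = a ^ n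
    F₀ = fib s t n
    F₁ = fib s t (suc n)
    bound₀ = proj₁ (consecutive n)
    bound₁ = proj₂ (consecutive n)
    regroup : ∀ b B s t F₁ F₀ → b * (b * B) * (s * F₁ + t * F₀) ≡ b * s * (b * B * F₁) + b * b * t * (B * F₀)
    regroup = solve-∀
    factor : ∀ b s t a A → b * s * (a * A) + b * b * t * A ≡ (b * s * a + b * b * t) * A
    factor = solve-∀

-- Bernoulli's inequality in the form  aⁿ (a + n) ≤ a (a + 1)ⁿ.
bernoulli : ∀ a n → a ^ n * (a + n) ≤ a * suc a ^ n
bernoulli a zero = ≤-reflexive (trans (*-identityˡ (a + 0)) (trans (+-identityʳ a) (sym (*-identityʳ a))))
bernoulli a (suc n) = begin
  a * a ^ n * (a + suc n)                   ≤⟨ m≤m+n _ (a ^ n * n) ⟩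
  a * a ^ n * (a + suc n) + a ^ n * n       ≡⟨ regroup a (a ^ n) n ⟩
  a ^ n * (a + n) * suc a                   ≤⟨ *-monoˡ-≤ (suc a) (bernoulli a n) ⟩
  a * suc a ^ n * suc a                     ≡⟨ reassociate a (suc a) (suc a ^ n) ⟩
  a * (suc a * suc a ^ n)                   ∎
  where
  open ≤-Reasoning
  regroup : ∀ a P n → a * P * (a + suc n) + P * n ≡ P * (a + n) * suc a
  regroup = solve-∀
  reassociate : ∀ a b P → a * P * b ≡ a * (b * P)
  reassociate = solve-∀

-- (a / (a+1))ⁿ < 1 / K once n ≥ K a: by Bernoulli,
-- K aⁿ (a + n) ≤ K a (a+1)ⁿ < (a + n)(a+1)ⁿ.
geometric-decay : ∀ a K n .{{_ : NonZero a}} → K * a ≤ n → K * a ^ n < suc a ^ n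
geometric-decay a K n Ka≤n = *-cancelʳ-< (a + n) (K * a ^ n) (suc a ^ n) (begin-strict
  K * a ^ n * (a + n)       ≡⟨ *-assoc K (a ^ n) (a + n) ⟩
  K * (a ^ n * (a + n))     ≤⟨ *-monoʳ-≤ K (bernoulli a n) ⟩
  K * (a * suc a ^ n)       ≡⟨ *-assoc K a (suc a ^ n) ⟨
  K * a * suc a ^ n         <⟨ *-monoˡ-< (suc a ^ n) {{m^n≢0 (suc a) n}} Ka<a+n ⟩
  (a + n) * suc a ^ n       ≡⟨ *-comm (a + n) (suc a ^ n) ⟩
  suc a ^ n * (a + n)       ∎)
  where
  open ≤-Reasoning
  Ka<a+n : K * a < a + n
  Ka<a+n = ≤-<-trans Ka≤n (m<n+m n (>-nonZero⁻¹ a))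

module Tail (x z : ℕ) where

  s t r q a : ℕ
  s = suc x
  t = suc z
  r = x + t
  q = suc r
  a = 2 + 3 * r

  instance
    r≢0 : NonZero r
    r≢0 = >-nonZero (≤-trans (s≤s z≤n) (m≤n+m t x))

  rqⁿ≢0 : ∀ n → NonZero (r * q ^ n)
  rqⁿ≢0 n = m*n≢0 r (q ^ n) {{r≢0}} {{m^n≢0 q n}}

  F : ℕ → ℕ
  F = fib s t

  -- The numerator of the tail after n terms.
  G : ℕ → ℕ
  G n = F (suc n) + t * F n

  G-recurrence : ∀ n → t * F n * r + G (suc n) ≡ q * G n
  G-recurrence n = identity x z (F (suc n)) (F n)
    where
    identity : ∀ x z F₁ F₀ → suc z * F₀ * (x + suc z) + ((suc x * F₁ + suc z * F₀) + suc z * F₁)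
                              ≡ suc (x + suc z) * (F₁ + suc z * F₀)
    identity = solve-∀

  -- μ = a/3 satisfies μ ≥ 1 and μ² ≥ sμ + t ...
  3≤a : 3 ≤ a
  3≤a = +-monoʳ-≤ 2 (≤-trans (>-nonZero⁻¹ r) (m≤n*m r 3))

  a-dominates : 3 * s * a + 3 * 3 * t ≤ a * a
  a-dominates = subst (3 * s * a + 3 * 3 * t ≤_) (sym (expand x z)) (m≤m+n _ _)
    where
    expand : ∀ x z → (2 + 3 * (x + suc z)) * (2 + 3 * (x + suc z))
                     ≡ 3 * suc x * (2 + 3 * (x + suc z)) + 3 * 3 * suc z
                       + (1 + 12 * z + 9 * (z * z) + 6 * x + 9 * (x * z))
    expand = solve-∀

  fib-bound : ∀ n → 3 ^ n * F n ≤ a ^ n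
  fib-bound = fib-growth s t a 3 3≤a a-dominates

  G-growth : ∀ n → 3 ^ suc n * G n ≤ (a + 3 * t) * a ^ n
  G-growth n = begin
    3 * P * (F (suc n) + t * F n)             ≡⟨ split P t (F (suc n)) (F n) ⟩
    3 * P * F (suc n) + 3 * t * (P * F n)     ≤⟨ +-mono-≤ (fib-bound (suc n)) (*-monoʳ-≤ (3 * t) (fib-bound n)) ⟩
    a * a ^ n + 3 * t * a ^ n                 ≡⟨ *-distribʳ-+ (a ^ n) a (3 * t) ⟨
    (a + 3 * t) * a ^ n                       ∎
    where
    open ≤-Reasoning
    P = 3 ^ n
    split : ∀ P t F₁ F₀ → 3 * P * (F₁ + t * F₀) ≡ 3 * P * F₁ + 3 * t * (P * F₀)
    split = solve-∀

  -- G n / (r qⁿ) < (p+1)/(d+1) once n ≥ (a + 3t)(d+1)a, after clearing denominators: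
  -- 3^(n+1) G n (d+1) ≤ (a + 3t)(d+1) aⁿ < (a+1)ⁿ = 3ⁿqⁿ ≤ 3^(n+1) (p+1) r qⁿ.
  G-small : ∀ p d n → (a + 3 * t) * suc d * a ≤ n → G n * suc d < suc p * (r * q ^ n)
  G-small p d n n-large = *-cancelˡ-< (3 ^ suc n) (G n * suc d) (suc p * (r * q ^ n)) (begin-strict
    3 ^ suc n * (G n * suc d)           ≡⟨ *-assoc (3 ^ suc n) (G n) (suc d) ⟨
    3 ^ suc n * G n * suc d             ≤⟨ *-monoˡ-≤ (suc d) (G-growth n) ⟩
    (a + 3 * t) * a ^ n * suc d         ≡⟨ swap (a + 3 * t) (a ^ n) (suc d) ⟩
    (a + 3 * t) * suc d * a ^ n         <⟨ geometric-decay a ((a + 3 * t) * suc d) n n-large ⟩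
    suc a ^ n                           ≡⟨ cong (_^ n) (suc-a≡3q r) ⟩
    (3 * q) ^ n                         ≡⟨ ^-distribʳ-* 3 q n ⟩
    3 ^ n * q ^ n                       ≤⟨ m≤n*m (3 ^ n * q ^ n) (3 * suc p * r) {{m*n≢0 (3 * suc p) r}} ⟩
    3 * suc p * r * (3 ^ n * q ^ n)     ≡⟨ regroup (suc p) r (3 ^ n) (q ^ n) ⟩
    3 ^ suc n * (suc p * (r * q ^ n))   ∎)
    where
    open ≤-Reasoning
    swap : ∀ c P e → c * P * e ≡ c * e * P
    swap = solve-∀
    suc-a≡3q : ∀ r → suc (2 + 3 * r) ≡ 3 * suc r
    suc-a≡3q = solve-∀
    regroup : ∀ p r T Q → 3 * p * r * (T * Q) ≡ 3 * T * (p * (r * Q))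
    regroup = solve-∀

  E : ℕ → ℚ
  E n = ((+ G n) / (r * q ^ n)) {{rqⁿ≢0 n}}

  E-drop : ∀ n → term s t n +ℚ E (suc n) ≡ E n
  E-drop n = /-+-cross (t * F n) (q ^ suc n) (G (suc n)) (r * q ^ suc n) (G n) (r * q ^ n)
                       {{m^n≢0 q (suc n)}} {{rqⁿ≢0 (suc n)}} {{rqⁿ≢0 n}} cross
    where
    open ≡-Reasoning
    Q = q ^ n
    factor : ∀ A C q r Q → (A * (r * (q * Q)) + C * (q * Q)) * (r * Q) ≡ q * Q * (r * Q) * (A * r + C)
    factor = solve-∀
    rearrange : ∀ g q r Q → q * Q * (r * Q) * (q * g) ≡ g * (q * Q * (r * (q * Q)))
    rearrange = solve-∀
    cross : (t * F n * (r * q ^ suc n) + G (suc n) * q ^ suc n) * (r * q ^ n)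
            ≡ G n * (q ^ suc n * (r * q ^ suc n))
    cross = begin
      (t * F n * (r * (q * Q)) + G (suc n) * (q * Q)) * (r * Q)  ≡⟨ factor (t * F n) (G (suc n)) q r Q ⟩
      q * Q * (r * Q) * (t * F n * r + G (suc n))                ≡⟨ cong (q * Q * (r * Q) *_) (G-recurrence n) ⟩
      q * Q * (r * Q) * (q * G n)                                ≡⟨ rearrange (G n) q r Q ⟩
      G n * (q * Q * (r * (q * Q)))                              ∎

  E₀≡1/r : E 0 ≡ (+ 1) / r
  E₀≡1/r = ℚ./-cong {{rqⁿ≢0 0}} (cong (λ k → + (1 + k)) (*-zeroʳ t)) (*-identityʳ r)

  partialSum+E≡1/r : ∀ N → partialSum s t N +ℚ E N ≡ (+ 1) / r
  partialSum+E≡1/r N = trans (telescope (term s t) E (partialSum s t) refl (λ _ → refl) E-drop N) E₀≡1/r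

  E≥0 : ∀ n → 0ℚ ≤ℚ E n
  E≥0 n = /-nonNeg (G n) (r * q ^ n) {{rqⁿ≢0 n}}

  E-small : ∀ ε → 0ℚ <ℚ ε → Σ ℕ λ N → ∀ n → n ≥ N → E n <ℚ ε
  E-small (mkℚ (+ suc p) d _) _ =
    (a + 3 * t) * suc d * a , λ n n-large → /-< (G n) (r * q ^ n) (suc p) d {{rqⁿ≢0 n}} (G-small p d n n-large)
  E-small (mkℚ (+ 0) _ _) (ℚ.*<* (ℤ.+<+ ()))
  E-small (mkℚ -[1+ _ ] _ _) (ℚ.*<* ())

corollary2p6 : (s t : ℕ) .{{_ : NonZero s}} .{{_ : NonZero t}} →
    ConvergesTo (partialSum s t) (_/_ (+ 1) (s + t ∸ 1) {{nz-s+t∸1 s t}})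
corollary2p6 (suc x) (suc z) = converges-by-tail (partialSum s t) E ((+ 1) / r) partialSum+E≡1/r E≥0 E-small
  where open Tail x z
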